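{- Let $G=(V,E)$ be a finite graph with $n=|V|$, and let $\Phi(G)=(\mathcal I,f)$ be defined as follows: $U=V\,\dot\cup\, D$ where $D$ is a set of $n$ new (dummy) elements; a set $S\subseteq U$ belongs to $\mathcal I$ if and only if $S\cap V$ is edge-independent in $G$ and $|S\cap D|\le n-|S\cap V|$; and $f:2^U\to\mathbb R$ is given by $f(S)=|S\cap V|$ for all $S\subseteq U$. Then (i) $\mathcal I$ is an independence system on $U$, and all maximal members (bases) of $\mathcal I$ have the same size; (ii) $f$ is monotone and submodular.
   Context: A set $A\subseteq V$ is edge-independent in $G$ if no two vertices of $A$ are joined by an edge. An independence system $\mathcal I$ on a finite set $U$ is a nonempty collection of subsets of $U$ closed under taking subsets; a basis is a member of $\mathcal I$ to which no element of $U$ can be added while remaining in $\mathcal I$. A function $f:2^U\to\mathbb R$ is submodular if for all $S\subseteq T\subseteq U$ and $x\in U\setminus T$, $f(T\cup\{x\})-f(T)\le f(S\cup\{x\})-f(S)$; it is monotone if $S\subseteq T$ implies $f(S)\le f(T)$. -}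

module Defs where

open import Data.Nat using (ℕ; _+_; _∸_; _≤_)
open import Data.Integer as ℤ using (ℤ; +_; _-_)
open import Data.Fin using (Fin)
open import Data.Fin.Subset using (Subset; _∈_; _∉_; _⊆_; _∪_; ⁅_⁆; ∣_∣)
open import Data.Vec using (take; drop)
open import Data.Product using (_×_; ∃)
open import Relation.Nullary using (¬_)
open import Relation.Binary.PropositionalEquality using (_≡_)

record Graph (n : ℕ) : Set₁ where
  field
    Adj    : Fin n → Fin n → Set
    sym    : ∀ {u v} → Adj u v → Adj v u
    irrefl : ∀ {u} → ¬ Adj u u
open Graph public

EdgeIndependent : ∀ {n} → Graph n → Subset n → Set
EdgeIndependent G A = ∀ u v → u ∈ A → v ∈ A → ¬ Adj G u v

IsIndependenceSystem : ∀ {m} → (Subset m → Set) → Set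
IsIndependenceSystem {m} I =
  ∃ (λ S → I S) × (∀ (S T : Subset m) → S ⊆ T → I T → I S)

IsBasis : ∀ {m} → (Subset m → Set) → Subset m → Set
IsBasis {m} I B = I B × (∀ (x : Fin m) → x ∉ B → ¬ I (B ∪ ⁅ x ⁆))

AllBasesSameSize : ∀ {m} → (Subset m → Set) → Set
AllBasesSameSize {m} I =
  ∀ (B B′ : Subset m) → IsBasis I B → IsBasis I B′ → ∣ B ∣ ≡ ∣ B′ ∣

Monotone : ∀ {m} → (Subset m → ℤ) → Set
Monotone {m} f = ∀ (S T : Subset m) → S ⊆ T → f S ℤ.≤ f T

Submodular : ∀ {m} → (Subset m → ℤ) → Set
Submodular {m} f = ∀ (S T : Subset m) (x : Fin m) → S ⊆ T → x ∉ T →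
  f (T ∪ ⁅ x ⁆) - f T ℤ.≤ f (S ∪ ⁅ x ⁆) - f S

-- Ground set U = V ⊔ D is Fin (n + n): the first n elements (Fin n via
-- inject+) are the vertices V, the last n (via raise n) are the dummies D.
-- For S ⊆ U, S ∩ V is  take n S  and S ∩ D is  drop n S.
ΦI : ∀ {n} → Graph n → Subset (n + n) → Set
ΦI {n} G S = EdgeIndependent G (take n S) × (∣ drop n S ∣ ≤ n ∸ ∣ take n S ∣)

Φf : ∀ {n} → Graph n → Subset (n + n) → ℤ
Φf {n} G S = + ∣ take n S ∣

-- Φf only looks at the vertex part S ∩ V, so it is modular (inclusion–exclusion for
-- cardinalities), and modular functions are submodular with equality. Every basis B
-- of ΦI has size n: otherwise |B ∩ D| < n − |B ∩ V|, and since |B ∩ D| < n some dummy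
-- is missing from B; adding it leaves B ∩ V unchanged and keeps the dummy budget, so
-- B was not maximal. Hence |B| = |B ∩ V| + (n − |B ∩ V|) = n.
module Submission where

open import Defs hiding (sym)
open import Data.Bool using (true; false; _∨_; _∧_)
open import Data.Nat using (ℕ; zero; suc; _+_; _∸_; _≤_; _<_; _<?_; z≤n; s≤s)
import Data.Nat.Properties as ℕ
open import Data.Integer as ℤ using (ℤ; _-_)
import Data.Integer.Properties as ℤ
open import Data.Integer.Tactic.RingSolver using (solve-∀)
open import Data.Fin using (Fin; zero; suc; _↑ʳ_)
open import Data.Fin.Subset using (Subset; _∈_; _∉_; _⊆_; _∪_; _∩_; ⊥; ⁅_⁆; ∣_∣)
open import Data.Fin.Subset.Properties
  using (drop-∷-⊆; ∉⊥; ∣⊥∣≡0; ∣⁅x⁆∣≡1; ∣p∣≤n; p⊆q⇒∣p∣≤∣q∣; ∪-identityʳ; ∩-zeroʳ)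
open import Data.Vec using ([]; _∷_; take; drop; here; there)
open import Data.Vec.Properties using (take-zipWith; drop-zipWith)
open import Data.Product using (_×_; _,_; ∃)
open import Relation.Nullary using (yes; no)
open import Relation.Nullary.Negation using (contradiction)
open import Relation.Binary.PropositionalEquality
open ≡-Reasoning

∣p∪q∣+∣p∩q∣≡∣p∣+∣q∣ : ∀ {k} (p q : Subset k) → ∣ p ∪ q ∣ + ∣ p ∩ q ∣ ≡ ∣ p ∣ + ∣ q ∣
∣p∪q∣+∣p∩q∣≡∣p∣+∣q∣ []          []          = refl
∣p∪q∣+∣p∩q∣≡∣p∣+∣q∣ (true ∷ p)  (true ∷ q)  = cong suc (begin
  ∣ p ∪ q ∣ + suc ∣ p ∩ q ∣  ≡⟨ ℕ.+-suc _ _ ⟩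
  suc (∣ p ∪ q ∣ + ∣ p ∩ q ∣) ≡⟨ cong suc (∣p∪q∣+∣p∩q∣≡∣p∣+∣q∣ p q) ⟩
  suc (∣ p ∣ + ∣ q ∣)         ≡⟨ ℕ.+-suc _ _ ⟨
  ∣ p ∣ + suc ∣ q ∣           ∎)
∣p∪q∣+∣p∩q∣≡∣p∣+∣q∣ (true ∷ p)  (false ∷ q) = cong suc (∣p∪q∣+∣p∩q∣≡∣p∣+∣q∣ p q)
∣p∪q∣+∣p∩q∣≡∣p∣+∣q∣ (false ∷ p) (true ∷ q)  =
  trans (cong suc (∣p∪q∣+∣p∩q∣≡∣p∣+∣q∣ p q)) (sym (ℕ.+-suc _ _))
∣p∪q∣+∣p∩q∣≡∣p∣+∣q∣ (false ∷ p) (false ∷ q) = ∣p∪q∣+∣p∩q∣≡∣p∣+∣q∣ p q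

x∉p⇒p∩⁅x⁆≡⊥ : ∀ {k} {p : Subset k} {x : Fin k} → x ∉ p → p ∩ ⁅ x ⁆ ≡ ⊥
x∉p⇒p∩⁅x⁆≡⊥ {p = true ∷ p}  {zero}  x∉p = contradiction here x∉p
x∉p⇒p∩⁅x⁆≡⊥ {p = false ∷ p} {zero}  x∉p = cong (false ∷_) (∩-zeroʳ p)
x∉p⇒p∩⁅x⁆≡⊥ {p = true ∷ p}  {suc x} x∉p = cong (false ∷_) (x∉p⇒p∩⁅x⁆≡⊥ (λ x∈p → x∉p (there x∈p)))
x∉p⇒p∩⁅x⁆≡⊥ {p = false ∷ p} {suc x} x∉p = cong (false ∷_) (x∉p⇒p∩⁅x⁆≡⊥ (λ x∈p → x∉p (there x∈p)))

x∉p⇒∣p∪⁅x⁆∣≡1+∣p∣ : ∀ {k} {p : Subset k} {x : Fin k} → x ∉ p → ∣ p ∪ ⁅ x ⁆ ∣ ≡ suc ∣ p ∣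
x∉p⇒∣p∪⁅x⁆∣≡1+∣p∣ {k} {p} {x} x∉p = begin
  ∣ p ∪ ⁅ x ⁆ ∣                    ≡⟨ ℕ.+-identityʳ _ ⟨
  ∣ p ∪ ⁅ x ⁆ ∣ + 0                ≡⟨ cong (∣ p ∪ ⁅ x ⁆ ∣ +_) (∣⊥∣≡0 k) ⟨
  ∣ p ∪ ⁅ x ⁆ ∣ + ∣ ⊥ {k} ∣         ≡⟨ cong (λ s → ∣ p ∪ ⁅ x ⁆ ∣ + ∣ s ∣) (x∉p⇒p∩⁅x⁆≡⊥ x∉p) ⟨
  ∣ p ∪ ⁅ x ⁆ ∣ + ∣ p ∩ ⁅ x ⁆ ∣    ≡⟨ ∣p∪q∣+∣p∩q∣≡∣p∣+∣q∣ p ⁅ x ⁆ ⟩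
  ∣ p ∣ + ∣ ⁅ x ⁆ ∣                ≡⟨ cong (∣ p ∣ +_) (∣⁅x⁆∣≡1 x) ⟩
  ∣ p ∣ + 1                        ≡⟨ ℕ.+-comm _ 1 ⟩
  suc ∣ p ∣                        ∎

∣p∣<n⇒∃x∉p : ∀ {k} (p : Subset k) → ∣ p ∣ < k → ∃ λ x → x ∉ p
∣p∣<n⇒∃x∉p (false ∷ p) _ = zero , λ ()
∣p∣<n⇒∃x∉p (true ∷ p) (s≤s ∣p∣<k) with ∣p∣<n⇒∃x∉p p ∣p∣<k
... | x , x∉p = suc x , λ { (there x∈p) → x∉p x∈p }

take-⊆ : ∀ m {k} {S T : Subset (m + k)} → S ⊆ T → take m S ⊆ take m T
take-⊆ (suc m) {S = true ∷ S} {t ∷ T} S⊆T here with S⊆T here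
... | here = here
take-⊆ (suc m) {S = s ∷ S} {t ∷ T} S⊆T (there x∈S) = there (take-⊆ m (drop-∷-⊆ S⊆T) x∈S)

drop-⊆ : ∀ m {k} {S T : Subset (m + k)} → S ⊆ T → drop m S ⊆ drop m T
drop-⊆ zero    S⊆T = S⊆T
drop-⊆ (suc m) {S = s ∷ S} {t ∷ T} S⊆T = drop-⊆ m (drop-∷-⊆ S⊆T)

take-⊥ : ∀ m {k} → take m (⊥ {m + k}) ≡ ⊥
take-⊥ zero    = refl
take-⊥ (suc m) = cong (false ∷_) (take-⊥ m)

drop-⊥ : ∀ m {k} → drop m (⊥ {m + k}) ≡ ⊥
drop-⊥ zero    = refl
drop-⊥ (suc m) = drop-⊥ m

take-⁅↑ʳ⁆ : ∀ m {k} (y : Fin k) → take m ⁅ m ↑ʳ y ⁆ ≡ ⊥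
take-⁅↑ʳ⁆ zero    y = refl
take-⁅↑ʳ⁆ (suc m) y = cong (false ∷_) (take-⁅↑ʳ⁆ m y)

drop-⁅↑ʳ⁆ : ∀ m {k} (y : Fin k) → drop m ⁅ m ↑ʳ y ⁆ ≡ ⁅ y ⁆
drop-⁅↑ʳ⁆ zero    y = refl
drop-⁅↑ʳ⁆ (suc m) y = drop-⁅↑ʳ⁆ m y

↑ʳ∈⇒∈drop : ∀ m {k} {S : Subset (m + k)} {y : Fin k} → m ↑ʳ y ∈ S → y ∈ drop m S
↑ʳ∈⇒∈drop zero    y∈S = y∈S
↑ʳ∈⇒∈drop (suc m) {S = s ∷ S} (there y∈S) = ↑ʳ∈⇒∈drop m y∈S

∣S∣≡∣take∣+∣drop∣ : ∀ m {k} (S : Subset (m + k)) → ∣ S ∣ ≡ ∣ take m S ∣ + ∣ drop m S ∣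
∣S∣≡∣take∣+∣drop∣ zero    S           = refl
∣S∣≡∣take∣+∣drop∣ (suc m) (true ∷ S)  = cong suc (∣S∣≡∣take∣+∣drop∣ m S)
∣S∣≡∣take∣+∣drop∣ (suc m) (false ∷ S) = ∣S∣≡∣take∣+∣drop∣ m S

take-∪-⁅↑ʳ⁆ : ∀ m {k} (S : Subset (m + k)) (y : Fin k) → take m (S ∪ ⁅ m ↑ʳ y ⁆) ≡ take m S
take-∪-⁅↑ʳ⁆ m S y = begin
  take m (S ∪ ⁅ m ↑ʳ y ⁆)          ≡⟨ take-zipWith _ S ⁅ m ↑ʳ y ⁆ ⟩
  take m S ∪ take m ⁅ m ↑ʳ y ⁆     ≡⟨ cong (take m S ∪_) (take-⁅↑ʳ⁆ m y) ⟩
  take m S ∪ ⊥                     ≡⟨ ∪-identityʳ (take m S) ⟩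
  take m S                         ∎

drop-∪-⁅↑ʳ⁆ : ∀ m {k} (S : Subset (m + k)) (y : Fin k) → drop m (S ∪ ⁅ m ↑ʳ y ⁆) ≡ drop m S ∪ ⁅ y ⁆
drop-∪-⁅↑ʳ⁆ m S y = trans (drop-zipWith _ S ⁅ m ↑ʳ y ⁆) (cong (drop m S ∪_) (drop-⁅↑ʳ⁆ m y))

Modular : ∀ {m} → (Subset m → ℤ) → Set
Modular {m} f = ∀ (S T : Subset m) → f (S ∪ T) ℤ.+ f (S ∩ T) ≡ f S ℤ.+ f T

module _ {m} (f : Subset m → ℤ) (f-modular : Modular f) where

  modular-gain : ∀ {T} {x} → x ∉ T → f (T ∪ ⁅ x ⁆) - f T ≡ f ⁅ x ⁆ - f ⊥
  modular-gain {T} {x} x∉T = begin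
    f (T ∪ X) - f T                                 ≡⟨ cancel (f (T ∪ X)) (f T) (f (T ∩ X)) ⟨
    (f (T ∪ X) ℤ.+ f (T ∩ X)) - (f T ℤ.+ f (T ∩ X)) ≡⟨ cong₂ _-_ (f-modular T X) (cong (λ S → f T ℤ.+ f S) (x∉p⇒p∩⁅x⁆≡⊥ x∉T)) ⟩
    (f T ℤ.+ f X) - (f T ℤ.+ f ⊥)                   ≡⟨ cong₂ _-_ (ℤ.+-comm (f T) (f X)) (ℤ.+-comm (f T) (f ⊥)) ⟩
    (f X ℤ.+ f T) - (f ⊥ ℤ.+ f T)                   ≡⟨ cancel (f X) (f ⊥) (f T) ⟩
    f X - f ⊥                                       ∎
    where
    X : Subset m
    X = ⁅ x ⁆
    cancel : ∀ a b c → (a ℤ.+ c) - (b ℤ.+ c) ≡ a - b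
    cancel = solve-∀

  modular⇒submodular : Submodular f
  modular⇒submodular S T x S⊆T x∉T =
    ℤ.≤-reflexive (trans (modular-gain x∉T) (sym (modular-gain (λ x∈S → x∉T (S⊆T x∈S)))))

module _ {n} (G : Graph n) where

  ΦI-⊥ : ΦI G ⊥
  ΦI-⊥ = edgeIndependent , subst (_≤ n ∸ ∣ take n (⊥ {n + n}) ∣) (sym ∣drop⊥∣≡0) z≤n
    where
    edgeIndependent : EdgeIndependent G (take n ⊥)
    edgeIndependent u v u∈ _ = contradiction (subst (u ∈_) (take-⊥ n) u∈) ∉⊥
    ∣drop⊥∣≡0 : ∣ drop n (⊥ {n + n}) ∣ ≡ 0
    ∣drop⊥∣≡0 = trans (cong ∣_∣ (drop-⊥ n)) (∣⊥∣≡0 n)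

  ΦI-⊆-closed : ∀ (S T : Subset (n + n)) → S ⊆ T → ΦI G T → ΦI G S
  ΦI-⊆-closed S T S⊆T (indep , budget) =
    (λ u v u∈ v∈ → indep u v (take-⊆ n S⊆T u∈) (take-⊆ n S⊆T v∈)) ,
    ℕ.≤-trans (p⊆q⇒∣p∣≤∣q∣ (drop-⊆ n S⊆T))
      (ℕ.≤-trans budget (ℕ.∸-monoʳ-≤ n (p⊆q⇒∣p∣≤∣q∣ (take-⊆ n S⊆T))))

  ΦI-add-dummy : ∀ {S} → ΦI G S → ∣ drop n S ∣ < n ∸ ∣ take n S ∣ →
                 ∃ λ x → x ∉ S × ΦI G (S ∪ ⁅ x ⁆)
  ΦI-add-dummy {S} (indep , _) slack with ∣p∣<n⇒∃x∉p (drop n S) ∣drop∣<n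
    where
    ∣drop∣<n : ∣ drop n S ∣ < n
    ∣drop∣<n = ℕ.<-≤-trans slack (ℕ.m∸n≤m n ∣ take n S ∣)
  ... | y , y∉drop = n ↑ʳ y , (λ x∈S → y∉drop (↑ʳ∈⇒∈drop n x∈S)) ,
    subst (EdgeIndependent G) (sym (take-∪-⁅↑ʳ⁆ n S y)) indep ,
    subst₂ (λ d t → d ≤ n ∸ ∣ t ∣)
      (sym (trans (cong ∣_∣ (drop-∪-⁅↑ʳ⁆ n S y)) (x∉p⇒∣p∪⁅x⁆∣≡1+∣p∣ y∉drop)))
      (sym (take-∪-⁅↑ʳ⁆ n S y))
      slack

  basis⇒∣B∣≡n : ∀ {B} → IsBasis (ΦI G) B → ∣ B ∣ ≡ n
  basis⇒∣B∣≡n {B} (B∈I , maximal) with ∣ drop n B ∣ <? n ∸ ∣ take n B ∣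
  ... | yes slack with ΦI-add-dummy B∈I slack
  ...   | x , x∉B , B∪x∈I = contradiction B∪x∈I (maximal x x∉B)
  basis⇒∣B∣≡n {B} ((_ , budget) , _) | no ¬slack = begin
    ∣ B ∣                                 ≡⟨ ∣S∣≡∣take∣+∣drop∣ n B ⟩
    ∣ take n B ∣ + ∣ drop n B ∣           ≡⟨ cong (∣ take n B ∣ +_) (ℕ.≤-antisym budget (ℕ.≮⇒≥ ¬slack)) ⟩
    ∣ take n B ∣ + (n ∸ ∣ take n B ∣)     ≡⟨ ℕ.m+[n∸m]≡n (∣p∣≤n (take n B)) ⟩
    n                                     ∎

  Φf-monotone : Monotone (Φf G)
  Φf-monotone S T S⊆T = ℤ.+≤+ (p⊆q⇒∣p∣≤∣q∣ (take-⊆ n S⊆T))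

  Φf-modular : Modular (Φf G)
  Φf-modular S T = begin
    ℤ.+ ∣ take n (S ∪ T) ∣ ℤ.+ ℤ.+ ∣ take n (S ∩ T) ∣
      ≡⟨ ℤ.pos-+ ∣ take n (S ∪ T) ∣ ∣ take n (S ∩ T) ∣ ⟨
    ℤ.+ (∣ take n (S ∪ T) ∣ + ∣ take n (S ∩ T) ∣)
      ≡⟨ cong₂ (λ U W → ℤ.+ (∣ U ∣ + ∣ W ∣)) (take-zipWith {m = n} _∨_ S T) (take-zipWith {m = n} _∧_ S T) ⟩
    ℤ.+ (∣ take n S ∪ take n T ∣ + ∣ take n S ∩ take n T ∣)
      ≡⟨ cong ℤ.+_ (∣p∪q∣+∣p∩q∣≡∣p∣+∣q∣ (take n S) (take n T)) ⟩
    ℤ.+ (∣ take n S ∣ + ∣ take n T ∣)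
      ≡⟨ ℤ.pos-+ ∣ take n S ∣ ∣ take n T ∣ ⟩
    ℤ.+ ∣ take n S ∣ ℤ.+ ℤ.+ ∣ take n T ∣
      ∎

mainTheorem1 : ∀ (n : ℕ) (G : Graph n) →
    (IsIndependenceSystem (ΦI G) × AllBasesSameSize (ΦI G))
    × (Monotone (Φf G) × Submodular (Φf G))
mainTheorem1 n G =
  (((⊥ , ΦI-⊥ G) , ΦI-⊆-closed G) ,
   λ B B′ B-basis B′-basis → trans (basis⇒∣B∣≡n G B-basis) (sym (basis⇒∣B∣≡n G B′-basis))) ,
  (Φf-monotone G , modular⇒submodular (Φf G) (Φf-modular G))
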